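{- Let $\varphi$ be a sentence of $\mathrm{dFO}[1,\Sigma,\{\sim_{(1,1)}\}]$ (also read as a sentence of $\mathrm{dFO}[2,\Sigma,\Gamma_2]$). There exists a $1$-data structure $\mathfrak{A}$ over $\Sigma$ with $\mathfrak{A}\models\varphi$ if and only if there exists a $2$-data structure $\mathfrak{B}$ over $\Sigma$ with $\mathfrak{B}\models\exists x.\langle\varphi\rangle^2_x$ (local formula evaluated with respect to $\Gamma_2$).
   Context: Let $\Sigma$ be a finite set of unary predicates and $D\ge1$. A $D$-data structure over $\Sigma$ is $(A,(P_\sigma)_{\sigma\in\Sigma},f_1,\dots,f_D)$ with $A$ nonempty finite, $P_\sigma\subseteq A$, $f_i:A\to\mathbb{N}$; $a\sim_{(i,j)}b$ iff $f_i(a)=f_j(b)$; $\Gamma_2=\{\sim_{(i,j)}:i,j\in\{1,2\}\}$. $\mathrm{dFO}[D,\Sigma,\Gamma]$ is first-order logic with atoms $\sigma(x)$, $x\sim y$ ($\sim\in\Gamma$), $x=y$. For a $2$-data structure and $\Gamma_2$: the data graph has vertices $A\times\{1,2\}$ and a directed edge $(a,i)\to(b,j)$ iff ($a=b$, $i\ne j$) or $f_i(a)=f_j(b)$; $B_r(a)$ is the set of vertices at directed distance $\le r$ from $(a,1)$ or $(a,2)$; the $r$-view $\mathfrak{B}|^r_a$ has universe $\{b:(b,i)\in B_r(a)$ for some $i\}$, restricted predicates, $i$-th value $f_i(b)$ if $(b,i)\in B_r(a)$, otherwise a fresh value (pairwise distinct, not among values of $\mathfrak{B}$). $\mathfrak{B}\models\exists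 x.\langle\varphi\rangle^2_x$ iff there is $a\in A$ with $\mathfrak{B}|^2_a\models\varphi$. -}

module Defs where

open import Data.Nat using (ℕ; zero; suc; _+_; _*_; _⊔_; _≡ᵇ_)
open import Data.Fin using (Fin; toℕ; inject₁) renaming (zero to fz; suc to fs)
open import Data.Fin.Properties using () renaming (_≟_ to _≟F_)
open import Data.Bool using (Bool; true; false; _∧_; _∨_; not; T)
open import Data.Product using (Σ; _×_; _,_; proj₁)
open import Data.Sum using (_⊎_)
open import Data.Empty using (⊥)
open import Relation.Nullary using (¬_)
open import Relation.Nullary.Decidable using (⌊_⌋)
open import Relation.Binary.PropositionalEquality using (_≡_)

-- Syntax of dFO[D, Σ, Γ] with Σ = Fin k and Γ = all (i,j) ∈ [D]×[D].
-- Formulas with n free variables (de Bruijn indices Fin n).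
-- For D = 1 the only data atom is ~(1,1), i.e. this is dFO[1,Σ,{~(1,1)}];
-- for D = 2 it is dFO[2,Σ,Γ₂].

data Form (D k : ℕ) : ℕ → Set where
  pred  : ∀ {n} → Fin k → Fin n → Form D k n
  sim   : ∀ {n} → Fin D → Fin D → Fin n → Fin n → Form D k n
  eq    : ∀ {n} → Fin n → Fin n → Form D k n
  neg   : ∀ {n} → Form D k n → Form D k n
  and   : ∀ {n} → Form D k n → Form D k n → Form D k n
  or    : ∀ {n} → Form D k n → Form D k n → Form D k n
  exi   : ∀ {n} → Form D k (suc n) → Form D k n
  all   : ∀ {n} → Form D k (suc n) → Form D k n

Sentence : ℕ → ℕ → Set
Sentence D k = Form D k 0

embed : ∀ {k n} → Form 1 k n → Form 2 k n
embed (pred σ x)    = pred σ x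
embed (sim i j x y) = sim (inject₁ i) (inject₁ j) x y
embed (eq x y)      = eq x y
embed (neg φ)       = neg (embed φ)
embed (and φ ψ)     = and (embed φ) (embed ψ)
embed (or φ ψ)      = or (embed φ) (embed ψ)
embed (exi φ)       = exi (embed φ)
embed (all φ)       = all (embed φ)

record Str (D k : ℕ) : Set₁ where
  field
    Carrier : Set
    P       : Fin k → Carrier → Bool
    val     : Fin D → Carrier → ℕ

cons : ∀ {A : Set} {n} → A → (Fin n → A) → Fin (suc n) → A
cons a ρ fz     = a
cons a ρ (fs i) = ρ i

Sat : ∀ {D k n} (𝔄 : Str D k) → Form D k n → (Fin n → Str.Carrier 𝔄) → Set
Sat 𝔄 (pred σ x)    ρ = T (Str.P 𝔄 σ (ρ x))
Sat 𝔄 (sim i j x y) ρ = Str.val 𝔄 i (ρ x) ≡ Str.val 𝔄 j (ρ y)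
Sat 𝔄 (eq x y)      ρ = ρ x ≡ ρ y
Sat 𝔄 (neg φ)       ρ = ¬ Sat 𝔄 φ ρ
Sat 𝔄 (and φ ψ)     ρ = Sat 𝔄 φ ρ × Sat 𝔄 ψ ρ
Sat 𝔄 (or φ ψ)      ρ = Sat 𝔄 φ ρ ⊎ Sat 𝔄 ψ ρ
Sat 𝔄 (exi φ)       ρ = Σ (Str.Carrier 𝔄) λ a → Sat 𝔄 φ (cons a ρ)
Sat 𝔄 (all φ)       ρ = (a : Str.Carrier 𝔄) → Sat 𝔄 φ (cons a ρ)

empty : ∀ {A : Set} → Fin 0 → A
empty ()

_⊨_ : ∀ {D k} → Str D k → Sentence D k → Set
𝔄 ⊨ φ = Sat 𝔄 φ empty

-- D-data structures: nonempty finite universe, taken (up to isomorphism)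
-- to be Fin (suc size).

record DS (D k : ℕ) : Set where
  field
    size : ℕ
    P    : Fin k → Fin (suc size) → Bool
    val  : Fin D → Fin (suc size) → ℕ

  Elem : Set
  Elem = Fin (suc size)

toStr : ∀ {D k} → DS D k → Str D k
toStr 𝔄 = record { Carrier = DS.Elem 𝔄 ; P = DS.P 𝔄 ; val = DS.val 𝔄 }

anyFin : ∀ {n} → (Fin n → Bool) → Bool
anyFin {zero}  p = false
anyFin {suc n} p = p fz ∨ anyFin (λ i → p (fs i))

maxFin : ∀ {n} → (Fin n → ℕ) → ℕ
maxFin {zero}  g = 0
maxFin {suc n} g = g fz ⊔ maxFin (λ i → g (fs i))

module _ {k : ℕ} (𝔅 : DS 2 k) where
  open DS 𝔅

  Vertex : Set
  Vertex = Elem × Fin 2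

  _==V_ : Vertex → Vertex → Bool
  (a , i) ==V (b , j) = ⌊ a ≟F b ⌋ ∧ ⌊ i ≟F j ⌋

  edge : Vertex → Vertex → Bool
  edge (a , i) (b , j) = (⌊ a ≟F b ⌋ ∧ not ⌊ i ≟F j ⌋) ∨ (val i a ≡ᵇ val j b)

  reach : ℕ → Vertex → Vertex → Bool
  reach zero    u v = u ==V v
  reach (suc r) u v = reach r u v ∨
    anyFin (λ b → anyFin (λ j → reach r u (b , j) ∧ edge (b , j) v))

  inBall : ℕ → Elem → Vertex → Bool
  inBall r a v = reach r (a , fz) v ∨ reach r (a , fs fz) v

  maxVal : ℕ
  maxVal = maxFin (λ b → val fz b ⊔ val (fs fz) b)

  -- fresh values: pairwise distinct and not among the values of 𝔅
  fresh : Elem → Fin 2 → ℕ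
  fresh b i = suc maxVal + (toℕ b * 2 + toℕ i)

  view : ℕ → Elem → Str 2 k
  view r a = record
    { Carrier = Σ Elem (λ b → T (inBall r a (b , fz) ∨ inBall r a (b , fs fz)))
    ; P       = λ σ b → P σ (proj₁ b)
    ; val     = λ i b → viewVal i (proj₁ b) (inBall r a (proj₁ b , i))
    }
    where
      viewVal : Fin 2 → Elem → Bool → ℕ
      viewVal i b true  = val i b
      viewVal i b false = fresh b i

_⊨∃local2_ : ∀ {k} → DS 2 k → Sentence 2 k → Set
𝔅 ⊨∃local2 φ = Σ (DS.Elem 𝔅) λ a → view 𝔅 2 a ⊨ φ

-- Formulas of dFO[1,Σ,{~(1,1)}] see only the predicates and the first values, so their
-- truth is invariant under bijections preserving these.  Giving a 1-data structure the
-- constant second value 0 yields edges (a,2) → (b,2) → (b,1) for all a, b; hence the 2-view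
-- of any element contains every element with its first value intact.  Conversely a 2-view
-- is a nonempty finite structure, so enumerating it and keeping first values gives a
-- 1-data structure.
module Submission where

open import Defs
open import Data.Bool using (Bool; true; false; T; _∨_; _∧_; if_then_else_)
open import Data.Bool.Properties using (T-∨; T-∧; T-≡; T-irrelevant)
open import Data.Empty using (⊥-elim)
open import Data.Fin using (Fin) renaming (zero to fz; suc to fs)
open import Data.Fin.Properties using (0↔⊥; 1↔⊤; +↔⊎; ¬Fin0) renaming (_≟_ to _≟F_)
open import Data.Nat using (ℕ; zero; suc)
open import Data.Product using (Σ; ∃; _,_; proj₁)
open import Data.Product.Function.NonDependent.Propositional using (_×-⇔_)
open import Data.Sum using (_⊎_; inj₁; inj₂)
open import Data.Sum.Function.Propositional using (_⊎-↔_; _⊎-⇔_)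
open import Function using (_∘_)
open import Function.Bundles using (_⇔_; _↔_; mk⇔; mk↔ₛ′; Equivalence; Inverse; Injection)
open import Function.Construct.Identity using (⇔-id)
open import Function.Properties.Inverse using (↔-sym; ↔-trans; ↔⇒↣)
open import Function.Related.TypeIsomorphisms using (¬-cong-⇔)
open import Relation.Nullary.Decidable using (⌊_⌋; fromWitness)
open import Relation.Binary.PropositionalEquality using (_≡_; refl; sym; cong)

open Inverse using (to; from; strictlyInverseˡ)

T-∨-introˡ : ∀ x y → T x → T (x ∨ y)
T-∨-introˡ x y = Equivalence.from (T-∨ {x} {y}) ∘ inj₁

T-∨-introʳ : ∀ x y → T y → T (x ∨ y)
T-∨-introʳ x y = Equivalence.from (T-∨ {x} {y}) ∘ inj₂

T-∧-intro : ∀ x y → T x → T y → T (x ∧ y)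
T-∧-intro x y tx ty = Equivalence.from (T-∧ {x} {y}) (tx , ty)

anyFin-intro : ∀ {n} (p : Fin n → Bool) i → T (p i) → T (anyFin p)
anyFin-intro p fz      pi = Equivalence.from T-∨ (inj₁ pi)
anyFin-intro p (fs i) pi = Equivalence.from T-∨ (inj₂ (anyFin-intro (p ∘ fs) i pi))

Σ-T-total↔ : ∀ {A : Set} {p : A → Bool} → (∀ x → T (p x)) → Σ A (T ∘ p) ↔ A
Σ-T-total↔ total = mk↔ₛ′ proj₁ (λ x → x , total x) (λ _ → refl)
  (λ { (x , px) → cong (x ,_) (T-irrelevant _ px) })

T↔Fin : ∀ b → T b ↔ Fin (if b then 1 else 0)
T↔Fin true  = ↔-sym 1↔⊤
T↔Fin false = ↔-sym 0↔⊥

Σ-Fin-suc↔ : ∀ {n} (p : Fin (suc n) → Bool) →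
  Σ (Fin (suc n)) (T ∘ p) ↔ (T (p fz) ⊎ Σ (Fin n) (T ∘ p ∘ fs))
Σ-Fin-suc↔ p = mk↔ₛ′ split join
  (λ { (inj₁ _) → refl ; (inj₂ _) → refl })
  (λ { (fz , _) → refl ; (fs _ , _) → refl })
  where
  split : Σ _ (T ∘ p) → T (p fz) ⊎ Σ _ (T ∘ p ∘ fs)
  split (fz   , pi) = inj₁ pi
  split (fs i , pi) = inj₂ (i , pi)
  join : T (p fz) ⊎ Σ _ (T ∘ p ∘ fs) → Σ _ (T ∘ p)
  join (inj₁ pi)       = fz , pi
  join (inj₂ (i , pi)) = fs i , pi

finite-subset : ∀ {n} (p : Fin n → Bool) → ∃ λ m → Σ (Fin n) (T ∘ p) ↔ Fin m
finite-subset {zero}  p = 0 , mk↔ₛ′ (λ { (() , _) }) (λ ()) (λ ()) (λ { (() , _) })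
finite-subset {suc n} p with finite-subset (p ∘ fs)
... | m , ι = _ , ↔-trans (Σ-Fin-suc↔ p) (↔-trans (T↔Fin (p fz) ⊎-↔ ι) (↔-sym +↔⊎))

inhabited-finite-subset : ∀ {n} (p : Fin n → Bool) → Σ (Fin n) (T ∘ p) →
  ∃ λ m → Fin (suc m) ↔ Σ (Fin n) (T ∘ p)
inhabited-finite-subset p x with finite-subset p
... | zero  , ι = ⊥-elim (¬Fin0 (to ι x))
... | suc m , ι = m , ↔-sym ι

module _ {k : ℕ} (𝔅 : DS 2 k) where

  reach-refl : ∀ r u → T (reach 𝔅 r u u)
  reach-refl zero    (a , i) = T-∧-intro ⌊ a ≟F a ⌋ ⌊ i ≟F i ⌋ (fromWitness refl) (fromWitness refl)
  reach-refl (suc r) u       = T-∨-introˡ (reach 𝔅 r u u) _ (reach-refl r u)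

  reach-step : ∀ r u w v → T (reach 𝔅 r u w) → T (edge 𝔅 w v) → T (reach 𝔅 (suc r) u v)
  reach-step r u (b , j) v uw wv = T-∨-introʳ (reach 𝔅 r u v) _
    (anyFin-intro (anyFin ∘ path-via) b
      (anyFin-intro (path-via b) j (T-∧-intro (reach 𝔅 r u (b , j)) _ uw wv)))
    where
    path-via : Fin (suc (DS.size 𝔅)) → Fin 2 → Bool
    path-via c i = reach 𝔅 r u (c , i) ∧ edge 𝔅 (c , i) v

  centre-∈-view : ∀ r a → Str.Carrier (view 𝔅 r a)
  centre-∈-view r a = a , T-∨-introˡ (inBall 𝔅 r a (a , fz)) _
    (T-∨-introˡ (reach 𝔅 r (a , fz) (a , fz)) _ (reach-refl r (a , fz)))

module _ {k : ℕ} {𝔄 : Str 1 k} {𝔅 : Str 2 k}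
         (ι : Str.Carrier 𝔄 ↔ Str.Carrier 𝔅)
         (P-to : ∀ σ a → Str.P 𝔄 σ a ≡ Str.P 𝔅 σ (to ι a))
         (val-to : ∀ a → Str.val 𝔄 fz a ≡ Str.val 𝔅 fz (to ι a)) where

  private
    Agree : ∀ {n} → (Fin n → Str.Carrier 𝔄) → (Fin n → Str.Carrier 𝔅) → Set
    Agree ρ ρ′ = ∀ i → ρ′ i ≡ to ι (ρ i)

    cons-agree : ∀ {n} {ρ ρ′} → Agree {n} ρ ρ′ → ∀ {a b} → b ≡ to ι a → Agree (cons a ρ) (cons b ρ′)
    cons-agree e b≡ fz     = b≡
    cons-agree e b≡ (fs i) = e i

  Sat-embed : ∀ {n} (φ : Form 1 k n) {ρ ρ′} → Agree ρ ρ′ → Sat 𝔄 φ ρ ⇔ Sat 𝔅 (embed φ) ρ′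
  Sat-embed (pred σ x) {ρ} e rewrite e x | P-to σ (ρ x) = ⇔-id _
  Sat-embed (sim fz fz x y) {ρ} e rewrite e x | e y | val-to (ρ x) | val-to (ρ y) = ⇔-id _
  Sat-embed (eq x y) e rewrite e x | e y = mk⇔ (cong (to ι)) (Injection.injective (↔⇒↣ ι))
  Sat-embed (neg φ)   e = ¬-cong-⇔ (Sat-embed φ e)
  Sat-embed (and φ ψ) e = Sat-embed φ e ×-⇔ Sat-embed ψ e
  Sat-embed (or φ ψ)  e = Sat-embed φ e ⊎-⇔ Sat-embed ψ e
  Sat-embed (exi φ) e = mk⇔
    (λ { (a , s) → to ι a , Equivalence.to (Sat-embed φ (cons-agree e refl)) s })
    (λ { (b , s) → from ι b ,
           Equivalence.from (Sat-embed φ (cons-agree e (sym (strictlyInverseˡ ι b)))) s })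
  Sat-embed (all φ) e = mk⇔
    (λ s b → Equivalence.to (Sat-embed φ (cons-agree e (sym (strictlyInverseˡ ι b)))) (s (from ι b)))
    (λ s a → Equivalence.from (Sat-embed φ (cons-agree e refl)) (s (to ι a)))

  ⊨-embed : (φ : Sentence 1 k) → 𝔄 ⊨ φ ⇔ 𝔅 ⊨ embed φ
  ⊨-embed φ = Sat-embed φ λ ()

pad₂ : ∀ {k} → DS 1 k → DS 2 k
pad₂ 𝔄 = record { size = DS.size 𝔄 ; P = DS.P 𝔄 ; val = val }
  where
  val : Fin 2 → DS.Elem 𝔄 → ℕ
  val fz     = DS.val 𝔄 fz
  val (fs _) = λ _ → 0

module _ {k : ℕ} (𝔄 : DS 1 k) where

  pad₂-inBall : ∀ a b → T (inBall (pad₂ 𝔄) 2 a (b , fz))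
  pad₂-inBall a b = T-∨-introʳ (reach (pad₂ 𝔄) 2 (a , fz) (b , fz)) _
    (reach-step (pad₂ 𝔄) 1 (a , fs fz) (b , fs fz) (b , fz)
      (reach-step (pad₂ 𝔄) 0 (a , fs fz) (a , fs fz) (b , fs fz)
        (reach-refl (pad₂ 𝔄) 0 (a , fs fz))
        (T-∨-introʳ (⌊ a ≟F b ⌋ ∧ false) true _))
      (T-∨-introˡ (⌊ b ≟F b ⌋ ∧ true) _ (T-∧-intro ⌊ b ≟F b ⌋ true (fromWitness refl) _)))

  pad₂-view↔ : ∀ a → DS.Elem 𝔄 ↔ Str.Carrier (view (pad₂ 𝔄) 2 a)
  pad₂-view↔ a = ↔-sym (Σ-T-total↔ λ b → Equivalence.from T-∨ (inj₁ (pad₂-inBall a b)))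

  pad₂-view-val : ∀ a b → DS.val 𝔄 fz b ≡ Str.val (view (pad₂ 𝔄) 2 a) fz (to (pad₂-view↔ a) b)
  pad₂-view-val a b rewrite Equivalence.to T-≡ (pad₂-inBall a b) = refl

  pad₂-⊨∃local2 : ∀ φ → toStr 𝔄 ⊨ φ → pad₂ 𝔄 ⊨∃local2 embed φ
  pad₂-⊨∃local2 φ sat =
    fz , Equivalence.to (⊨-embed (pad₂-view↔ fz) (λ _ _ → refl) (pad₂-view-val fz) φ) sat

forget₂ : ∀ {k m} (𝔅 : Str 2 k) → Fin (suc m) ↔ Str.Carrier 𝔅 → DS 1 k
forget₂ {m = m} 𝔅 ι = record
  { size = m
  ; P    = λ σ i → Str.P 𝔅 σ (to ι i)
  ; val  = λ _ i → Str.val 𝔅 fz (to ι i)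
  }

forget₂-⊨ : ∀ {k m} {𝔅 : Str 2 k} (ι : Fin (suc m) ↔ Str.Carrier 𝔅) φ →
  𝔅 ⊨ embed φ → toStr (forget₂ 𝔅 ι) ⊨ φ
forget₂-⊨ ι φ = Equivalence.from (⊨-embed ι (λ _ _ → refl) (λ _ → refl) φ)

⊨∃local2⇒model : ∀ {k} (φ : Sentence 1 k) (𝔅 : DS 2 k) →
  𝔅 ⊨∃local2 embed φ → Σ (DS 1 k) λ 𝔄 → toStr 𝔄 ⊨ φ
⊨∃local2⇒model φ 𝔅 (a , sat) with inhabited-finite-subset _ (centre-∈-view 𝔅 2 a)
... | _ , ι = forget₂ (view 𝔅 2 a) ι , forget₂-⊨ ι φ sat

lemma4p6 : {k : ℕ} (φ : Sentence 1 k) →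
    (Σ (DS 1 k) λ 𝔄 → toStr 𝔄 ⊨ φ) ⇔ (Σ (DS 2 k) λ 𝔅 → 𝔅 ⊨∃local2 embed φ)
lemma4p6 φ = mk⇔
  (λ { (𝔄 , sat) → pad₂ 𝔄 , pad₂-⊨∃local2 𝔄 φ sat })
  (λ { (𝔅 , sat) → ⊨∃local2⇒model φ 𝔅 sat })
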